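{- Let $\Sigma=\{a_1,a_2,\dots\}$ be a countably infinite alphabet, $\Sigma_2=\{e,f\}$, and $g\colon\Sigma^*\to\Sigma_2^*$ the monoid homomorphism with $g(a_i)=ef^ie$, extended to languages by $g(M)=\{g(w)\mid w\in M\}$. Let $L_0\subseteq\Sigma^*$ and $M\subseteq\Sigma^*$. If $M$ contains a non-empty word and $M^{\rhd}\neq\varnothing$ (closure w.r.t. $L_0$), then $g(M^{\rhd\lhd})=(g(M))^{\rhd\lhd}$, where the closure on the left is taken with respect to $L_0$ over $\Sigma$ and the closure on the right with respect to $g(L_0)$ over $\Sigma_2$.
   Context: For an alphabet $\Delta$ and a language $L\subseteq\Delta^*$: for $M\subseteq\Delta^*$, $M^{\rhd}=\{(x,y)\in\Delta^*\times\Delta^*\mid\forall w\in M\;xwy\in L\}$, and for $C\subseteq\Delta^*\times\Delta^*$, $C^{\lhd}=\{v\in\Delta^*\mid\forall(x,y)\in C\;xvy\in L\}$. -}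

module Defs where

open import Data.Nat using (ℕ; suc)
open import Data.List using (List; []; _∷_; _++_; concatMap; replicate)
open import Data.Product using (_×_; _,_; ∃)
open import Relation.Binary.PropositionalEquality using (_≡_)
open import Level using (0ℓ)

Lang : Set → Set₁
Lang A = List A → Set

Ctx : Set → Set₁
Ctx A = List A × List A → Set

_▷[_] : {A : Set} → Lang A → Lang A → Ctx A
(M ▷[ L ]) (x , y) = ∀ w → M w → L (x ++ w ++ y)

_◁[_] : {A : Set} → Ctx A → Lang A → Lang A
(C ◁[ L ]) v = ∀ x y → C (x , y) → L (x ++ v ++ y)

closure : {A : Set} → Lang A → Lang A → Lang A
closure L M = (M ▷[ L ]) ◁[ L ]

_≐_ : {A : Set} → Lang A → Lang A → Set
L ≐ K = (∀ w → L w → K w) × (∀ w → K w → L w)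

-- Countably infinite alphabet Σ = {a₁, a₂, …}: the letter aᵢ is encoded
-- by the natural number i - 1, i.e. n : ℕ stands for a_{n+1}.
Σ : Set
Σ = ℕ

data Σ₂ : Set where
  e f : Σ₂

-- g(a_i) = e f^i e ; with the encoding n ↦ a_{n+1}, g(n) = e f^{n+1} e
gLetter : Σ → List Σ₂
gLetter n = e ∷ replicate (suc n) f ++ e ∷ []

g : List Σ → List Σ₂
g = concatMap gLetter

gLang : Lang Σ → Lang Σ₂
gLang M u = ∃ λ w → M w × g w ≡ u

{-# OPTIONS --safe #-}
module Submission where

open import Defs
open import Data.Nat using (zero; suc)
open import Data.List using (List; []; _∷_; _++_; replicate)
open import Data.List.Properties using (++-assoc; ++-identityʳ; ∷-injectiveʳ; concatMap-++)
open import Data.Empty using (⊥-elim)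
open import Data.Product using (∃; _×_; _,_; proj₂)
open import Function.Definitions using (Injective)
open import Relation.Binary.PropositionalEquality

-- The code words e fⁿ⁺¹ e form a prefix code, so g is injective and g(Σ*) is left
-- unitary; moreover every factor e f of a word in g(Σ*) starts a code word. So if
-- m ∈ M is non-empty and x g(m) y ∈ g(L₀), then x, and hence y, lie in g(Σ*):
-- every context of g(M) is the image of a context of M. Dually, a context
-- (x₀ , y₀) of M gives g(x₀) u g(y₀) ∈ g(L₀) for every u in the closure of g(M),
-- which puts u in g(Σ*). Injectivity of g then transports membership both ways.

InImage : List Σ₂ → Set
InImage u = ∃ λ w → g w ≡ u

g-++ : ∀ u v → g (u ++ v) ≡ g u ++ g v
g-++ = concatMap-++ gLetter

g-++-++ : ∀ x w y → g (x ++ w ++ y) ≡ g x ++ g w ++ g y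
g-++-++ x w y = trans (g-++ x (w ++ y)) (cong (g x ++_) (g-++ w y))

gLetter-++ : ∀ a s → gLetter a ++ s ≡ e ∷ replicate (suc a) f ++ e ∷ s
gLetter-++ a s = cong (e ∷_) (++-assoc (replicate (suc a) f) (e ∷ []) s)

g≢f∷ : ∀ l {s} → g l ≢ f ∷ s
g≢f∷ [] ()
g≢f∷ (_ ∷ _) ()

replicate-f-e-cancel : ∀ j k {s t} → replicate j f ++ e ∷ s ≡ replicate k f ++ e ∷ t → j ≡ k × s ≡ t
replicate-f-e-cancel zero    zero    refl = refl , refl
replicate-f-e-cancel (suc j) (suc k) eq with replicate-f-e-cancel j k (∷-injectiveʳ eq)
... | refl , s≡t = refl , s≡t

gLetter-cancel : ∀ a b {s t} → gLetter a ++ s ≡ gLetter b ++ t → a ≡ b × s ≡ t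
gLetter-cancel a b {s} {t} eq
  with replicate-f-e-cancel (suc a) (suc b) (∷-injectiveʳ (trans (sym (gLetter-++ a s)) (trans eq (gLetter-++ b t))))
... | refl , s≡t = refl , s≡t

g-injective : Injective _≡_ _≡_ g
g-injective {[]}    {[]}    _  = refl
g-injective {a ∷ u} {b ∷ v} eq with gLetter-cancel a b eq
... | refl , gu≡gv = cong (a ∷_) (g-injective gu≡gv)

g-cancelˡ-image : ∀ p l {y} → g l ≡ g p ++ y → InImage y
g-cancelˡ-image []      l       eq = l , eq
g-cancelˡ-image (a ∷ p) (b ∷ l) {y} eq =
  g-cancelˡ-image p l (proj₂ (gLetter-cancel b a (trans eq (++-assoc (gLetter a) (g p) y))))

replicate-f-e-split : ∀ k x {r t} → (∀ {s} → t ≢ f ∷ s) → replicate k f ++ e ∷ t ≡ x ++ e ∷ f ∷ r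
                    → ∃ λ x₂ → x ≡ replicate k f ++ e ∷ x₂ × t ≡ x₂ ++ e ∷ f ∷ r
replicate-f-e-split zero    []      t≢f∷ refl = ⊥-elim (t≢f∷ refl)
replicate-f-e-split zero    (e ∷ x) _    refl = x , refl , refl
replicate-f-e-split (suc k) (f ∷ x) t≢f∷ eq with replicate-f-e-split k x t≢f∷ (∷-injectiveʳ eq)
... | x₂ , refl , t≡ = x₂ , refl , t≡

ef-starts-code-word : ∀ l x {r} → g l ≡ x ++ e ∷ f ∷ r → InImage x
ef-starts-code-word (b ∷ l) []      _ = [] , refl
ef-starts-code-word (b ∷ l) (e ∷ x) eq
  with replicate-f-e-split (suc b) x (g≢f∷ l) (∷-injectiveʳ (trans (sym (gLetter-++ b (g l))) eq))
... | x₂ , refl , gl≡ with ef-starts-code-word l x₂ gl≡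
... | w , refl = b ∷ w , gLetter-++ b (g w)

g-cancelʳ-image : ∀ s l {u} → g l ≡ u ++ g s → InImage u
g-cancelʳ-image []      l {u} eq = l , trans eq (++-identityʳ u)
g-cancelʳ-image (_ ∷ _) l     eq = ef-starts-code-word l _ eq

module _ {L M : Lang Σ} where

  gLang-++⁻¹ : ∀ x w y → gLang L (g x ++ g w ++ g y) → L (x ++ w ++ y)
  gLang-++⁻¹ x w y (v , Lv , eq) = subst L (g-injective (trans eq (sym (g-++-++ x w y)))) Lv

  g-▷ : ∀ x y → (M ▷[ L ]) (x , y) → (gLang M ▷[ gLang L ]) (g x , g y)
  g-▷ x y c _ (m , Mm , refl) = x ++ m ++ y , c m Mm , g-++-++ x m y

  g-▷⁻¹ : ∀ x y → (gLang M ▷[ gLang L ]) (g x , g y) → (M ▷[ L ]) (x , y)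
  g-▷⁻¹ x y c m Mm = gLang-++⁻¹ x m y (c (g m) (m , Mm , refl))

  ▷-image : ∀ {a v} x y → M (a ∷ v) → (gLang M ▷[ gLang L ]) (x , y) → InImage x × InImage y
  ▷-image {a} {v} x y Mav c with c (g (a ∷ v)) (a ∷ v , Mav , refl)
  ... | l , _ , eq with ef-starts-code-word l x eq
  ... | x′ , refl with g-cancelˡ-image x′ l eq
  ... | l′ , eq′ = (x′ , refl) , g-cancelˡ-image (a ∷ v) l′ eq′

  closure-image : ∀ {u} → ∃ (M ▷[ L ]) → closure (gLang L) (gLang M) u → InImage u
  closure-image ((x , y) , c) cu with cu (g x) (g y) (g-▷ x y c)
  ... | l , _ , eq with g-cancelˡ-image x l eq
  ... | l′ , eq′ = g-cancelʳ-image y l′ eq′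

  closure-g : ∀ {a v w} → M (a ∷ v) → closure L M w → closure (gLang L) (gLang M) (g w)
  closure-g {w = w} Mav cw x y c with ▷-image x y Mav c
  ... | (x′ , refl) , (y′ , refl) = x′ ++ w ++ y′ , cw x′ y′ (g-▷⁻¹ x′ y′ c) , g-++-++ x′ w y′

  closure-g⁻¹ : ∀ {w} → closure (gLang L) (gLang M) (g w) → closure L M w
  closure-g⁻¹ {w} cw x y c = gLang-++⁻¹ x w y (cw (g x) (g y) (g-▷ x y c))

lemma8 : (L₀ M : Lang Σ)
    → (∃ λ a → ∃ λ w → M (a ∷ w))
    → ∃ (M ▷[ L₀ ])
    → gLang (closure L₀ M) ≐ closure (gLang L₀) (gLang M)
lemma8 L₀ M (_ , _ , Mav) M▷-nonempty = ⊆ , ⊇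
  where
  ⊆ : ∀ u → gLang (closure L₀ M) u → closure (gLang L₀) (gLang M) u
  ⊆ _ (w , cw , refl) = closure-g Mav cw

  ⊇ : ∀ u → closure (gLang L₀) (gLang M) u → gLang (closure L₀ M) u
  ⊇ u cu with closure-image M▷-nonempty cu
  ... | w , refl = w , closure-g⁻¹ cu , refl
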